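{- For every $n\ge 2$, $\gamma_{tR2}(P_n)=\left\lceil \frac{2n+2}{3}\right\rceil$, where $P_n$ is the path on $n$ vertices.
   Context: For a graph $G$ and $f:V(G)\to\{0,1,2\}$ let $V_i=\{v:f(v)=i\}$; $f$ is a total Roman $\{2\}$-dominating function (TR2DF) if every vertex $v$ with $f(v)=0$ has a neighbor $u$ with $f(u)=2$ or two distinct neighbors $x,y$ with $f(x)=f(y)=1$, and the subgraph induced by $V_1\cup V_2$ has no isolated vertices. $\gamma_{tR2}(G)$ is the minimum weight $\sum_v f(v)$ of a TR2DF of $G$. -}

module Defs where

open import Data.Nat using (ℕ; zero; suc; _+_; _≤_)
open import Data.Nat.DivMod using (_/_)
open import Data.Fin using (Fin; toℕ)
open import Data.Product using (Σ; ∃; _×_; _,_)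
open import Data.Sum using (_⊎_)
open import Relation.Binary.PropositionalEquality using (_≡_; _≢_)

record Graph (n : ℕ) : Set₁ where
  field
    Adj : Fin n → Fin n → Set

open Graph public

Path : (n : ℕ) → Graph n
Path n = record { Adj = λ i j → (suc (toℕ i) ≡ toℕ j) ⊎ (suc (toℕ j) ≡ toℕ i) }

data Label : Set where
  l0 l1 l2 : Label

val : Label → ℕ
val l0 = 0
val l1 = 1
val l2 = 2

sumFin : (n : ℕ) → (Fin n → ℕ) → ℕ
sumFin zero    g = 0
sumFin (suc n) g = g Fin.zero + sumFin n (λ i → g (Fin.suc i))


weight : {n : ℕ} → (Fin n → Label) → ℕ
weight {n} f = sumFin n (λ v → val (f v))

record IsTR2DF {n : ℕ} (G : Graph n) (f : Fin n → Label) : Set where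
  field
    dom : (v : Fin n) → f v ≡ l0 →
          (∃ λ u → Adj G v u × f u ≡ l2)
          ⊎ (∃ λ x → ∃ λ y → x ≢ y × Adj G v x × Adj G v y × f x ≡ l1 × f y ≡ l1)
    total : (v : Fin n) → f v ≢ l0 → ∃ λ u → Adj G v u × f u ≢ l0

IsγtR2 : {n : ℕ} → Graph n → ℕ → Set
IsγtR2 G k =
  (Σ _ λ f → IsTR2DF G f × weight f ≡ k)
  × (∀ f → IsTR2DF G f → k ≤ weight f)

ceil3 : ℕ → ℕ
ceil3 m = (m + 2) / 3

-- A labelling of P_n is a TR2DF exactly when, at every vertex, the labels of its (at most
-- two) neighbours sum to at least 2 if the vertex is labelled 0 and to at least 1 otherwise.
-- Reading the path from left to right, a potential ψ on pairs of consecutive labels satisfies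
-- ψ(a,b) + 2 ≤ 3c + ψ(b,c) whenever the vertex labelled b meets this condition, ψ(a,b) ≤ 2
-- at the right end, and 6 ≤ 3b + ψ(0,b) at the left end; telescoping gives 3·w(f) ≥ 2n + 2.
-- The bound is attained by 1 1 0 1 1 0 … 1 1, followed by one or two more 1s when n ≢ 2 (mod 3).

module Submission where

open import Defs
open import Data.Empty using (⊥-elim)
open import Data.Fin using (Fin; zero; suc; toℕ; inject₁)
open import Data.Fin.Properties using (toℕ-injective; toℕ-inject₁)
open import Data.Nat using (ℕ; zero; suc; _+_; _*_; _≤_; _≤?_; s≤s; z≤n)
open import Data.Nat.Divisibility using (divides-refl)
open import Data.Nat.DivMod using (_/_; /-monoˡ-≤; +-distrib-/-∣ˡ; m*n/n≡m)
open import Data.Nat.Properties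
  using ( suc-injective; ≤-refl; ≤-reflexive; ≤-trans; <⇒≢; n<1+n; m<n⇒m<1+n; m≤m+n; m≤n+m
        ; +-comm; +-assoc; +-identityʳ; *-comm; +-mono-≤; +-monoˡ-≤; +-cancelˡ-≤; +-cancelʳ-≤
        ; module ≤-Reasoning )
open import Data.Nat.Tactic.RingSolver using (solve-∀)
open import Data.Product using (∃; _×_; _,_)
open import Data.Sum using (_⊎_; inj₁; inj₂)
open import Data.Vec.Functional using (Vector; []; _∷_; head; tail)
open import Function using (_∘_; case_of_)
open import Relation.Binary.PropositionalEquality
open import Relation.Nullary.Decidable using (Dec; True; toWitness; _→-dec_)

demand : Label → ℕ
demand l0 = 2
demand l1 = 1
demand l2 = 1

-- The condition of a TR2DF at a vertex labelled b whose neighbours are labelled a and c, where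
-- a missing neighbour is read as one labelled 0: a 0 needs a neighbouring 2 or two neighbouring
-- 1s, a positive label needs a positive neighbour.
LocalCondition : Label → Label → Label → Set
LocalCondition a b c = demand b ≤ val a + val c

localCondition? : ∀ a b c → Dec (LocalCondition a b c)
localCondition? a b c = demand b ≤? val a + val c

firstLabel : ∀ {n} → Vector Label n → Label
firstLabel {zero}  _ = l0
firstLabel {suc _} f = head f

leftLabel : ∀ {n} → Label → Vector Label n → Fin n → Label
leftLabel a f zero    = a
leftLabel a f (suc v) = leftLabel (head f) (tail f) v

rightLabel : ∀ {n} → Vector Label n → Fin n → Label
rightLabel f zero    = firstLabel (tail f)
rightLabel f (suc v) = rightLabel (tail f) v

LocallyTR2 : ∀ {n} → Label → Vector Label n → Set
LocallyTR2 a f = ∀ v → LocalCondition (leftLabel a f v) (f v) (rightLabel f v)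

neighbourSum : ∀ {n} → Vector Label n → Fin n → ℕ
neighbourSum f v = val (leftLabel l0 f v) + val (rightLabel f v)

two-or-ones : ∀ {a c} → 2 ≤ val a + val c → (a ≡ l2 ⊎ c ≡ l2) ⊎ (a ≡ l1 × c ≡ l1)
two-or-ones {l2}      _ = inj₁ (inj₁ refl)
two-or-ones {c = l2}  _ = inj₁ (inj₂ refl)
two-or-ones {l1} {l1} _ = inj₂ (refl , refl)
two-or-ones {l0} {l0} ()
two-or-ones {l0} {l1} (s≤s ())
two-or-ones {l1} {l0} (s≤s ())

some-nonzero : ∀ {a c} → 1 ≤ val a + val c → a ≢ l0 ⊎ c ≢ l0
some-nonzero {l1}      _ = inj₁ λ ()
some-nonzero {l2}      _ = inj₁ λ ()
some-nonzero {l0} {l1} _ = inj₂ λ ()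
some-nonzero {l0} {l2} _ = inj₂ λ ()
some-nonzero {l0} {l0} ()

nonzero⇒1≤val : ∀ {a} → a ≢ l0 → 1 ≤ val a
nonzero⇒1≤val {l0} a≢l0 = ⊥-elim (a≢l0 refl)
nonzero⇒1≤val {l1} _    = s≤s z≤n
nonzero⇒1≤val {l2} _    = s≤s z≤n

1≤demand : ∀ b → 1 ≤ demand b
1≤demand l0 = s≤s z≤n
1≤demand l1 = s≤s z≤n
1≤demand l2 = s≤s z≤n

leftLabel-suc : ∀ {n} a (f : Vector Label (suc n)) (v : Fin n) →
                leftLabel a f (suc v) ≡ f (inject₁ v)
leftLabel-suc a f zero    = refl
leftLabel-suc a f (suc v) = leftLabel-suc (head f) (tail f) v

left-neighbour : ∀ {n} (f : Vector Label n) {u v} → suc (toℕ u) ≡ toℕ v → leftLabel l0 f v ≡ f u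
left-neighbour f {v = suc v} e = trans (leftLabel-suc l0 f v)
  (cong f (toℕ-injective (trans (toℕ-inject₁ v) (sym (suc-injective e)))))

left-witness : ∀ {n} (f : Vector Label n) {v x} → leftLabel l0 f v ≡ x → x ≢ l0 →
               ∃ λ u → suc (toℕ u) ≡ toℕ v × f u ≡ x
left-witness f {zero}  refl x≢l0 = ⊥-elim (x≢l0 refl)
left-witness f {suc v} refl _    = inject₁ v , cong suc (toℕ-inject₁ v) , sym (leftLabel-suc l0 f v)

right-neighbour : ∀ {n} (f : Vector Label n) {u v} → suc (toℕ v) ≡ toℕ u → rightLabel f v ≡ f u
right-neighbour f {suc zero} {zero}  refl = refl
right-neighbour f {suc u}    {suc v} e    = right-neighbour (tail f) (suc-injective e)

right-witness : ∀ {n} (f : Vector Label n) {v x} → rightLabel f v ≡ x → x ≢ l0 →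
                ∃ λ u → suc (toℕ v) ≡ toℕ u × f u ≡ x
right-witness {suc zero}    f {zero}  refl x≢l0 = ⊥-elim (x≢l0 refl)
right-witness {suc (suc _)} f {zero}  refl _    = suc zero , refl , refl
right-witness               f {suc v} e    x≢l0 =
  let u , e′ , fu = right-witness (tail f) e x≢l0 in suc u , cong suc e′ , fu

left≢right : ∀ {n} {x y v : Fin n} → suc (toℕ x) ≡ toℕ v → suc (toℕ v) ≡ toℕ y → x ≢ y
left≢right ex ey refl = <⇒≢ (m<n⇒m<1+n (n<1+n _)) (sym (trans (cong suc ex) ey))

neighbour-bound : ∀ {n} (f : Vector Label n) {v u} → Adj (Path n) v u →
                  val (f u) ≤ neighbourSum f v
neighbour-bound f (inj₁ e) = ≤-trans (≤-reflexive (cong val (sym (right-neighbour f e)))) (m≤n+m _ _)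
neighbour-bound f (inj₂ e) = ≤-trans (≤-reflexive (cong val (sym (left-neighbour f e)))) (m≤m+n _ _)

distinct-neighbours-bound : ∀ {n} (f : Vector Label n) {v x y} → x ≢ y →
                            Adj (Path n) v x → Adj (Path n) v y →
                            val (f x) + val (f y) ≤ neighbourSum f v
distinct-neighbours-bound f x≢y (inj₁ ex) (inj₁ ey) = ⊥-elim (x≢y (toℕ-injective (trans (sym ex) ey)))
distinct-neighbours-bound f x≢y (inj₂ ex) (inj₂ ey) =
  ⊥-elim (x≢y (toℕ-injective (suc-injective (trans ex (sym ey)))))
distinct-neighbours-bound f {x = x} {y} _ (inj₁ ex) (inj₂ ey) =
  ≤-reflexive (trans (+-comm (val (f x)) (val (f y)))
    (cong₂ _+_ (cong val (sym (left-neighbour f ey))) (cong val (sym (right-neighbour f ex)))))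
distinct-neighbours-bound f _ (inj₂ ex) (inj₁ ey) =
  ≤-reflexive (cong₂ _+_ (cong val (sym (left-neighbour f ex)))
                         (cong val (sym (right-neighbour f ey))))

isTR2DF⇒locallyTR2 : ∀ {n} (f : Vector Label n) → IsTR2DF (Path n) f → LocallyTR2 l0 f
isTR2DF⇒locallyTR2 f D v = meets (f v) refl
  where
  open IsTR2DF D
  supported : f v ≢ l0 → 1 ≤ neighbourSum f v
  supported f≢l0 = let u , adj , fu≢l0 = total v f≢l0 in
    ≤-trans (nonzero⇒1≤val fu≢l0) (neighbour-bound f adj)
  meets : ∀ b → f v ≡ b → demand b ≤ neighbourSum f v
  meets l0 fv with dom v fv
  ... | inj₁ (u , adj , fu) = subst (λ y → val y ≤ neighbourSum f v) fu (neighbour-bound f adj)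
  ... | inj₂ (x , y , x≢y , ax , ay , fx , fy) =
    subst₂ (λ p q → val p + val q ≤ neighbourSum f v) fx fy (distinct-neighbours-bound f x≢y ax ay)
  meets l1 fv = supported λ e → case trans (sym fv) e of λ ()
  meets l2 fv = supported λ e → case trans (sym fv) e of λ ()

locallyTR2⇒isTR2DF : ∀ {n} (f : Vector Label n) → LocallyTR2 l0 f → IsTR2DF (Path n) f
locallyTR2⇒isTR2DF {n} f h = record { dom = dom ; total = total }
  where
  dom : ∀ v → f v ≡ l0 →
        (∃ λ u → Adj (Path n) v u × f u ≡ l2)
        ⊎ (∃ λ x → ∃ λ y → x ≢ y × Adj (Path n) v x × Adj (Path n) v y × f x ≡ l1 × f y ≡ l1)
  dom v fv with two-or-ones (subst (λ b → demand b ≤ neighbourSum f v) fv (h v))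
  ... | inj₁ (inj₁ L≡l2) = let u , e , fu = left-witness f L≡l2 (λ ()) in inj₁ (u , inj₂ e , fu)
  ... | inj₁ (inj₂ R≡l2) = let u , e , fu = right-witness f R≡l2 (λ ()) in inj₁ (u , inj₁ e , fu)
  ... | inj₂ (L≡l1 , R≡l1) =
    let x , ex , fx = left-witness f L≡l1 (λ ())
        y , ey , fy = right-witness f R≡l1 (λ ())
    in inj₂ (x , y , left≢right ex ey , inj₂ ex , inj₁ ey , fx , fy)
  total : ∀ v → f v ≢ l0 → ∃ λ u → Adj (Path n) v u × f u ≢ l0
  total v _ with some-nonzero (≤-trans (1≤demand (f v)) (h v))
  ... | inj₁ L≢l0 = let u , e , fu = left-witness f refl L≢l0 in
                    u , inj₂ e , subst (_≢ l0) (sym fu) L≢l0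
  ... | inj₂ R≢l0 = let u , e , fu = right-witness f refl R≢l0 in
                    u , inj₁ e , subst (_≢ l0) (sym fu) R≢l0

record All (P : Label → Set) : Set where
  field
    at-l0 : P l0
    at-l1 : P l1
    at-l2 : P l2

all : ∀ {P} → All P → ∀ x → P x
all ps l0 = All.at-l0 ps
all ps l1 = All.at-l1 ps
all ps l2 = All.at-l2 ps

-- The `checked` argument is left as `_`: every `True (P? …)` in it normalises to ⊤ (to ⊥ if
-- the check fails), so Agda fills it in by η-expansion.
decide¹ : ∀ {P : Label → Set} (P? : ∀ a → Dec (P a)) →
          All (λ a → True (P? a)) → ∀ a → P a
decide¹ P? checked a = toWitness (all checked a)

decide² : ∀ {P : Label → Label → Set} (P? : ∀ a b → Dec (P a b)) →
          All (λ a → All λ b → True (P? a b)) → ∀ a b → P a b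
decide² P? checked a = decide¹ (P? a) (all checked a)

decide³ : ∀ {P : Label → Label → Label → Set} (P? : ∀ a b c → Dec (P a b c)) →
          All (λ a → All λ b → All λ c → True (P? a b c)) → ∀ a b c → P a b c
decide³ P? checked a = decide² (P? a) (all checked a)

-- potential a b is meant as a lower bound for 3·w(g) + 2 − 2·k, where g labels the k vertices
-- that follow a vertex labelled b, itself preceded by one labelled a, and the local condition
-- holds at b and throughout g.
potential : Label → Label → ℕ
potential l0 l0 = 7
potential l0 _  = 3
potential l1 l0 = 4
potential l1 l1 = 2
potential l1 l2 = 0
potential l2 l2 = 0
potential l2 _  = 2

step-bound : ∀ a b c → LocalCondition a b c → potential a b + 2 ≤ 3 * val c + potential b c
step-bound = decide³ (λ a b c → localCondition? a b c →-dec _ ≤? _) _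

end-bound : ∀ a b → LocalCondition a b l0 → potential a b ≤ 2
end-bound = decide² (λ a b → localCondition? a b l0 →-dec _ ≤? _) _

-- The left end of the path behaves as if preceded by a state of potential 4.
start-bound : ∀ b → 4 + 2 ≤ 3 * val b + potential l0 b
start-bound = decide¹ (λ b → _ ≤? _) _

telescope-step : ∀ {p q x s m} → p + 2 ≤ 3 * x + q → 2 * m + q ≤ 3 * s + 2 →
                 2 * suc m + p ≤ 3 * (x + s) + 2
telescope-step {p} {q} {x} {s} {m} step rest = +-cancelˡ-≤ q _ _ (begin
  q + (2 * suc m + p)        ≡⟨ regroupˡ q m p ⟩
  (p + 2) + (2 * m + q)      ≤⟨ +-mono-≤ step rest ⟩
  (3 * x + q) + (3 * s + 2)  ≡⟨ regroupʳ x q s ⟩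
  q + (3 * (x + s) + 2)      ∎)
  where
  open ≤-Reasoning
  regroupˡ : ∀ q m p → q + (2 * suc m + p) ≡ (p + 2) + (2 * m + q)
  regroupˡ = solve-∀
  regroupʳ : ∀ x q s → (3 * x + q) + (3 * s + 2) ≡ q + (3 * (x + s) + 2)
  regroupʳ = solve-∀

potential-bound : ∀ {n} a (f : Vector Label (suc n)) → LocallyTR2 a f →
                  2 * n + potential a (head f) ≤ 3 * weight (tail f) + 2
potential-bound {zero}  a f h = end-bound a (head f) (h zero)
potential-bound {suc n} a f h =
  telescope-step {x = val (f (suc zero))} {s = weight (tail (tail f))} {m = n}
    (step-bound a (head f) (f (suc zero)) (h zero))
    (potential-bound (head f) (tail f) (h ∘ suc))

weight-lower-bound : ∀ {n} (f : Vector Label (suc n)) → LocallyTR2 l0 f →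
                     2 * suc n + 2 ≤ 3 * weight f
weight-lower-bound {n} f h = +-cancelʳ-≤ 2 _ _ (begin
  2 * suc n + 2 + 2   ≡⟨ +-assoc (2 * suc n) 2 2 ⟩
  2 * suc n + 4       ≤⟨ from-both-ends ⟩
  3 * weight f + 2    ∎)
  where
  open ≤-Reasoning
  from-both-ends : 2 * suc n + 4 ≤ 3 * weight f + 2
  from-both-ends = telescope-step {x = val (head f)} {s = weight (tail f)} {m = n}
    (start-bound (head f)) (potential-bound l0 f h)

ceil3-≤ : ∀ {m w} → m ≤ 3 * w → ceil3 m ≤ w
ceil3-≤ {m} {w} m≤3w = begin
  (m + 2) / 3          ≤⟨ /-monoˡ-≤ 3 (+-monoˡ-≤ 2 (≤-trans m≤3w (≤-reflexive (*-comm 3 w)))) ⟩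
  (w * 3 + 2) / 3      ≡⟨ +-distrib-/-∣ˡ 2 (divides-refl w) ⟩
  w * 3 / 3 + 0        ≡⟨ +-identityʳ _ ⟩
  w * 3 / 3            ≡⟨ m*n/n≡m w 3 ⟩
  w                    ∎
  where open ≤-Reasoning

ceil3-+6 : ∀ m → ceil3 (6 + m) ≡ 2 + ceil3 m
ceil3-+6 m = +-distrib-/-∣ˡ (m + 2) {3} (divides-refl 2)

optimal-suffix : ∀ m → Vector Label m
optimal-suffix 0 = []
optimal-suffix 1 = l1 ∷ []
optimal-suffix 2 = l1 ∷ l1 ∷ []
optimal-suffix (suc (suc (suc m))) = l0 ∷ l1 ∷ l1 ∷ optimal-suffix m

optimal : ∀ m → Vector Label (2 + m)
optimal m = l1 ∷ l1 ∷ optimal-suffix m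

optimal-suffix-locallyTR2 : ∀ m → LocallyTR2 l1 (optimal-suffix m)
optimal-suffix-locallyTR2 1 zero = ≤-refl
optimal-suffix-locallyTR2 2 zero = s≤s z≤n
optimal-suffix-locallyTR2 2 (suc zero) = ≤-refl
optimal-suffix-locallyTR2 (suc (suc (suc m))) zero = ≤-refl
optimal-suffix-locallyTR2 (suc (suc (suc m))) (suc zero) = ≤-refl
optimal-suffix-locallyTR2 (suc (suc (suc m))) (suc (suc zero)) = s≤s z≤n
optimal-suffix-locallyTR2 (suc (suc (suc m))) (suc (suc (suc v))) = optimal-suffix-locallyTR2 m v

optimal-locallyTR2 : ∀ m → LocallyTR2 l0 (optimal m)
optimal-locallyTR2 m zero = ≤-refl
optimal-locallyTR2 m (suc zero) = s≤s z≤n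
optimal-locallyTR2 m (suc (suc v)) = optimal-suffix-locallyTR2 m v

weight-optimal : ∀ m → weight (optimal m) ≡ ceil3 (2 * (2 + m) + 2)
weight-optimal 0 = refl
weight-optimal 1 = refl
weight-optimal 2 = refl
weight-optimal (suc (suc (suc m))) = begin
  weight (optimal (3 + m))              ≡⟨⟩
  2 + weight (optimal m)                ≡⟨ cong (2 +_) (weight-optimal m) ⟩
  2 + ceil3 (2 * (2 + m) + 2)           ≡⟨ ceil3-+6 (2 * (2 + m) + 2) ⟨
  ceil3 (6 + (2 * (2 + m) + 2))         ≡⟨ cong ceil3 (shift m) ⟩
  ceil3 (2 * (2 + suc (suc (suc m))) + 2) ∎
  where
  open ≡-Reasoning
  shift : ∀ m → 6 + (2 * (2 + m) + 2) ≡ 2 * (2 + suc (suc (suc m))) + 2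
  shift = solve-∀

mainTheorem8 : (n : ℕ) → 2 ≤ n → IsγtR2 (Path n) (ceil3 (2 * n + 2))
mainTheorem8 (suc (suc m)) _ =
    (optimal m , locallyTR2⇒isTR2DF (optimal m) (optimal-locallyTR2 m) , weight-optimal m)
  , λ f isTR2DF → ceil3-≤ (weight-lower-bound f (isTR2DF⇒locallyTR2 f isTR2DF))
mainTheorem8 (suc zero) (s≤s ())
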